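{- For every integer $n\ge1$, $$m(n)\ge C(n):=(n-1)!+n-2+\sum_{d\mid n}\bigl|\mathrm{cycles}^{(1)}(d)\bigr|.$$
   Context: Let $n\ge1$ and $[n]=\{1,\dots,n\}$. A permutation $\pi\in S_n$ is identified with its one-line word $\pi(1)\pi(2)\cdots\pi(n)$. Let $\sigma\in S_n$ be the cycle $\sigma(i)=i+1$ for $i<n$, $\sigma(n)=1$; values and positions are taken modulo $n$ with representatives in $[n]$. For $\pi\in S_n$ let $\mathrm{inc}(\pi)=\{\sigma^k\circ\pi: 0\le k\le n-1\}$, and let $\mathcal{R}_2$ be the equivalence relation $\pi\,\mathcal{R}_2\,\pi'\iff\pi'\in\mathrm{inc}(\pi)$; it has $(n-1)!$ classes. A word $u$ over $[n]$ is a universal word for $\mathcal{R}_2$ if for every $\pi\in S_n$ some contiguous factor $u(i)\cdots u(i+n-1)$ of $u$ equals the one-line word of some element of $\mathrm{inc}(\pi)$. $m(n)$ denotes the minimal length of a universal word for $\mathcal{R}_2$. The map $f(\mathrm{inc}(\pi))=\mathrm{inc}(\pi\circ\sigma)$ is a well-defined permutation of the set of $\mathcal{R}_2$-classes. A 1-cycle is an orbit of $f$ (a class fixed by $f$ is a 1-cycle of length 1). $\mathrm{cycles}^{(1)}(d)$ denotes the set of 1-cycles consisting of exactly $d$ classes. -}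

module Defs where

open import Data.Nat using (ℕ; zero; suc; _+_; _∸_; _≤_; _<_; NonZero)
open import Data.Nat.DivMod using (_mod_)
open import Data.Nat.ListAction using (sum)
open import Data.Nat.Divisibility using (_∣?_)
open import Data.Fin using (Fin; toℕ)
open import Data.Fin.Permutation using (Permutation′; _⟨$⟩ʳ_)
open import Data.List using (List; []; _∷_; _++_; tabulate; length; map; filter; applyUpTo)
open import Data.List.Relation.Unary.All using (All)
open import Data.List.Relation.Unary.Any using (Any)
open import Data.List.Relation.Unary.AllPairs using (AllPairs)
open import Data.Product using (Σ; ∃; ∃-syntax; _×_)
open import Relation.Nullary using (¬_)
open import Relation.Binary.PropositionalEquality using (_≡_)

-- Convention: the alphabet [n] = {1,…,n} is represented by Fin n = {0,…,n-1}
-- (value v ∈ [n] ↔ v-1 ∈ Fin n); positions likewise.  A one-line word of a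
-- permutation is its underlying function Fin n → Fin n.

module _ (n : ℕ) ⦃ nz : NonZero n ⦄ where

  shift : ℕ → Fin n → Fin n
  shift k v = (toℕ v + k) mod n

  word : Permutation′ n → Fin n → Fin n
  word π i = π ⟨$⟩ʳ i

  σ^_∘_ : ℕ → (Fin n → Fin n) → (Fin n → Fin n)
  (σ^ k ∘ w) i = shift k (w i)

  _∘σ^_ : (Fin n → Fin n) → ℕ → (Fin n → Fin n)
  (w ∘σ^ j) i = w (shift j i)

  -- π R₂ π'  ⟺  π' ∈ inc(π) = {σ^k ∘ π : 0 ≤ k ≤ n-1}
  R₂ : (Fin n → Fin n) → (Fin n → Fin n) → Set
  R₂ w w' = ∃[ k ] (k < n × (∀ i → w' i ≡ (σ^ k ∘ w) i))

  Factor : List (Fin n) → (Fin n → Fin n) → Set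
  Factor u w = ∃[ xs ] ∃[ ys ] (u ≡ xs ++ tabulate w ++ ys)

  Universal : List (Fin n) → Set
  Universal u = ∀ (π : Permutation′ n) →
    ∃[ π' ] (R₂ (word π) π' × Factor u π')

  -- f(inc π) = inc(π ∘ σ); so f^j(inc π) = inc(π ∘ σ^j).
  -- The 1-cycle (f-orbit) of inc π consists of exactly d classes.
  OrbitSize : ℕ → Permutation′ n → Set
  OrbitSize d π =
    1 ≤ d × R₂ (word π) (word π ∘σ^ d) ×
    (∀ j → 1 ≤ j → j < d → ¬ R₂ (word π) (word π ∘σ^ j))

  -- inc π and inc π' lie in the same 1-cycle: inc π' = f^j (inc π) for some j
  SameOrbit : Permutation′ n → Permutation′ n → Set
  SameOrbit π π' = ∃[ j ] R₂ (word π ∘σ^ j) (word π')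

  -- |cycles⁽¹⁾(d)| = c : there is a list of c permutations, one from each
  -- 1-cycle of size d (pairwise in distinct 1-cycles, every 1-cycle of
  -- size d hit).
  CyclesCount : ℕ → ℕ → Set
  CyclesCount d c = Σ (List (Permutation′ n)) λ L →
    length L ≡ c ×
    All (OrbitSize d) L ×
    AllPairs (λ π π' → ¬ SameOrbit π π') L ×
    (∀ π → OrbitSize d π → Any (SameOrbit π) L)

divisors : ℕ → List ℕ
divisors n = filter (λ d → d ∣? n) (applyUpTo suc n)

sumDiv : ℕ → (ℕ → ℕ) → ℕ
sumDiv n c = sum (map c (divisors n))

module Submission where

-- Call p a permutation position of u if the window u(p) ⋯ u(p + n − 1) is a
-- permutation word. Consecutive permutation windows share n − 1 letters, so the
-- letter leaving equals the letter entering and the second window is the first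
-- precomposed with σ: a maximal run of permutation positions stays inside one
-- 1-cycle. The (n − 1)! classes need (n − 1)! distinct positions p, and the
-- 1-cycles need distinct runs, each starting at 0 or right after a position
-- that is not a permutation position. Hence the numbers p + 1 and the run
-- starts are (n − 1)! + Σ_{d ∣ n} |cycles⁽¹⁾(d)| distinct values in
-- [0, |u| − n + 1].

open import Defs
open import Data.Nat using (ℕ; zero; suc; _+_; _*_; _∸_; _≤_; _<_; NonZero; _!; z≤n; s≤s; _%_)
open import Data.Nat.Properties
open import Data.Nat.DivMod using (%-distribˡ-+; m%n%n≡m%n; [m+kn]%n≡m%n; m%n<n; m<n⇒m%n≡m; n%n≡0)
open import Data.Nat.Divisibility using (_∣_; _∣?_)
open import Data.Nat.ListAction using (sum)
open import Data.Fin using (Fin; toℕ; fromℕ<; inject₁; remQuot; combine)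
import Data.Fin.Properties as Fin
open import Data.Fin.Permutation
  using (Permutation′; _⟨$⟩ʳ_; _⟨$⟩ˡ_; inverseˡ; inverseʳ; id; lift₀; transpose; _∘ₚ_)
open import Data.List using (List; []; _∷_; _++_; tabulate; length; map; lookup; applyUpTo)
open import Data.List.Properties using (length-++; length-map; length-tabulate)
open import Data.List.Membership.Propositional using (_∈_)
open import Data.List.Membership.Propositional.Properties using (∈-lookup; ∈-map⁻; ∈-tabulate⁻)
open import Data.List.Relation.Unary.All as All using (All; []; _∷_)
import Data.List.Relation.Unary.All.Properties as All
open import Data.List.Relation.Unary.AllPairs as AllPairs using (AllPairs; []; _∷_)
import Data.List.Relation.Unary.AllPairs.Properties as AllPairs
open import Data.List.Relation.Unary.Any using (here; there)
open import Data.List.Relation.Unary.Unique.Propositional using (Unique)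
open import Data.List.Relation.Binary.Disjoint.Propositional using (Disjoint)
import Data.List.Relation.Unary.Unique.Propositional.Properties as Unique
open import Data.Product using (Σ; ∃-syntax; _×_; _,_; proj₁; proj₂; uncurry)
open import Data.Product.Properties using (×-≡,≡→≡)
open import Data.Empty using (⊥-elim)
open import Relation.Nullary using (¬_; Dec; yes; no)
open import Relation.Nullary.Decidable using (_→-dec_; _×-dec_)
open import Relation.Binary using (tri<; tri≈; tri>)
open import Relation.Binary.PropositionalEquality

lookupOr : ∀ {A : Set} → A → List A → ℕ → A
lookupOr d []       _       = d
lookupOr d (x ∷ xs) zero    = x
lookupOr d (x ∷ xs) (suc k) = lookupOr d xs k

lookupOr-++ : ∀ {A : Set} (d : A) xs ys k → lookupOr d (xs ++ ys) (length xs + k) ≡ lookupOr d ys k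
lookupOr-++ d []       ys k = refl
lookupOr-++ d (x ∷ xs) ys k = lookupOr-++ d xs ys k

lookupOr-tabulate : ∀ {A : Set} {k} (d : A) (f : Fin k → A) ys i → lookupOr d (tabulate f ++ ys) (toℕ i) ≡ f i
lookupOr-tabulate d f ys Fin.zero    = refl
lookupOr-tabulate d f ys (Fin.suc i) = lookupOr-tabulate d (λ j → f (Fin.suc j)) ys i

length-++-tabulate-≥ : ∀ {A : Set} {k} xs (f : Fin k → A) ys → length xs + k ≤ length (xs ++ tabulate f ++ ys)
length-++-tabulate-≥ {k = k} xs f ys = begin
  length xs + k                                  ≤⟨ +-monoʳ-≤ (length xs) (m≤m+n k (length ys)) ⟩
  length xs + (k + length ys)                    ≡⟨ cong (λ j → length xs + (j + length ys)) (length-tabulate f) ⟨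
  length xs + (length (tabulate f) + length ys)  ≡⟨ cong (length xs +_) (length-++ (tabulate f)) ⟨
  length xs + length (tabulate f ++ ys)          ≡⟨ length-++ xs ⟨
  length (xs ++ tabulate f ++ ys)                ∎
  where open ≤-Reasoning

lookup-injective : ∀ {A : Set} {xs : List A} → Unique xs → ∀ {i j} → lookup xs i ≡ lookup xs j → i ≡ j
lookup-injective (_ ∷ _)      {Fin.zero}  {Fin.zero}  _  = refl
lookup-injective (x∉xs ∷ _)   {Fin.zero}  {Fin.suc j} eq = ⊥-elim (All.lookup x∉xs (∈-lookup j) eq)
lookup-injective (x∉xs ∷ _)   {Fin.suc i} {Fin.zero}  eq = ⊥-elim (All.lookup x∉xs (∈-lookup i) (sym eq))
lookup-injective (_ ∷ unique) {Fin.suc i} {Fin.suc j} eq = cong Fin.suc (lookup-injective unique eq)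

unique-bounded⇒length≤ : ∀ {K} {xs : List ℕ} → Unique xs → All (_< K) xs → length xs ≤ K
unique-bounded⇒length≤ {K} {xs} unique bounded = Fin.injective⇒≤ {f = index} index-injective
  where
  index : Fin (length xs) → Fin K
  index i = fromℕ< (All.lookup bounded (∈-lookup i))
  index-injective : ∀ {i j} → index i ≡ index j → i ≡ j
  index-injective eq = lookup-injective unique (Fin.fromℕ<-injective _ _ _ _ eq)

divisors-unique : ∀ n → Unique (divisors n)
divisors-unique n = Unique.filter⁺ (_∣? n) (Unique.applyUpTo⁺₁ suc n (λ i<j _ eq → <-irrefl (suc-injective eq) i<j))

-- cons i π sends 0 to i.
cons : ∀ {k} → Fin (suc k) → Permutation′ k → Permutation′ (suc k)
cons i π = lift₀ π ∘ₚ transpose Fin.zero i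

cons-injective : ∀ {k} {i i' : Fin (suc k)} {π π'} → (cons i π ⟨$⟩ʳ_) ≗ (cons i' π' ⟨$⟩ʳ_) →
                 i ≡ i' × (π ⟨$⟩ʳ_) ≗ (π' ⟨$⟩ʳ_)
cons-injective {k} {i} {π = π} {π'} same with same Fin.zero
... | refl = refl , λ t → Fin.suc-injective (begin
  lift₀ π ⟨$⟩ʳ Fin.suc t                               ≡⟨ inverseˡ τ ⟨
  τ ⟨$⟩ˡ (cons i π ⟨$⟩ʳ Fin.suc t)                     ≡⟨ cong (τ ⟨$⟩ˡ_) (same (Fin.suc t)) ⟩
  τ ⟨$⟩ˡ (cons i π' ⟨$⟩ʳ Fin.suc t)                    ≡⟨ inverseˡ τ ⟩
  lift₀ π' ⟨$⟩ʳ Fin.suc t                              ∎)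
  where
  open ≡-Reasoning
  τ : Permutation′ (suc k)
  τ = transpose Fin.zero i

permutation : (k : ℕ) → Fin (k !) → Permutation′ k
permutation zero    _ = id
permutation (suc k) x = let (i , j) = remQuot {suc k} (k !) x in cons i (permutation k j)

permutation-injective : ∀ k {x y} → (permutation k x ⟨$⟩ʳ_) ≗ (permutation k y ⟨$⟩ʳ_) → x ≡ y
permutation-injective zero    {Fin.zero} {Fin.zero} _ = refl
permutation-injective (suc k) {x} {y} same with i≡i' , tails ← cons-injective same = begin
  x                                     ≡⟨ Fin.combine-remQuot {suc k} (k !) x ⟨
  uncurry combine (remQuot {suc k} _ x)  ≡⟨ cong (uncurry combine) quotients ⟩
  uncurry combine (remQuot {suc k} _ y)  ≡⟨ Fin.combine-remQuot {suc k} (k !) y ⟩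
  y                                     ∎
  where
  open ≡-Reasoning
  quotients : remQuot {suc k} (k !) x ≡ remQuot (k !) y
  quotients = ×-≡,≡→≡ (i≡i' , permutation-injective k tails)

module Rotation (m : ℕ) where

  n : ℕ
  n = suc m

  Word : Set
  Word = Fin n → Fin n

  open ≡-Reasoning

  [a%n+b]%n≡[a+b]%n : ∀ a b → (a % n + b) % n ≡ (a + b) % n
  [a%n+b]%n≡[a+b]%n a b = begin
    (a % n + b) % n          ≡⟨ %-distribˡ-+ (a % n) b n ⟩
    (a % n % n + b % n) % n  ≡⟨ cong (λ x → (x + b % n) % n) (m%n%n≡m%n a n) ⟩
    (a % n + b % n) % n      ≡⟨ %-distribˡ-+ a b n ⟨
    (a + b) % n              ∎

  [a+b%n]%n≡[a+b]%n : ∀ a b → (a + b % n) % n ≡ (a + b) % n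
  [a+b%n]%n≡[a+b]%n a b = begin
    (a + b % n) % n  ≡⟨ cong (_% n) (+-comm a (b % n)) ⟩
    (b % n + a) % n  ≡⟨ [a%n+b]%n≡[a+b]%n b a ⟩
    (b + a) % n      ≡⟨ cong (_% n) (+-comm b a) ⟩
    (a + b) % n      ∎

  toℕ-shift : ∀ k v → toℕ (shift n k v) ≡ (toℕ v + k) % n
  toℕ-shift k v = Fin.toℕ-fromℕ< _

  shift-≡ : ∀ a b v v' → (toℕ v + a) % n ≡ (toℕ v' + b) % n → shift n a v ≡ shift n b v'
  shift-≡ a b v v' eq = Fin.toℕ-injective (trans (toℕ-shift a v) (trans eq (sym (toℕ-shift b v'))))

  shift-zero : ∀ v → shift n 0 v ≡ v
  shift-zero v = Fin.toℕ-injective (begin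
    toℕ (shift n 0 v)  ≡⟨ toℕ-shift 0 v ⟩
    (toℕ v + 0) % n    ≡⟨ cong (_% n) (+-identityʳ (toℕ v)) ⟩
    toℕ v % n          ≡⟨ m<n⇒m%n≡m (Fin.toℕ<n v) ⟩
    toℕ v              ∎)

  shift-shift : ∀ a b v → shift n a (shift n b v) ≡ shift n (b + a) v
  shift-shift a b v = shift-≡ a (b + a) (shift n b v) v (begin
    (toℕ (shift n b v) + a) % n  ≡⟨ cong (λ x → (x + a) % n) (toℕ-shift b v) ⟩
    ((toℕ v + b) % n + a) % n    ≡⟨ [a%n+b]%n≡[a+b]%n (toℕ v + b) a ⟩
    (toℕ v + b + a) % n          ≡⟨ cong (_% n) (+-assoc (toℕ v) b a) ⟩
    (toℕ v + (b + a)) % n        ∎)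

  shift-periodic : ∀ a k v → shift n (a + k * n) v ≡ shift n a v
  shift-periodic a k v = shift-≡ (a + k * n) a v v (begin
    (toℕ v + (a + k * n)) % n  ≡⟨ cong (_% n) (+-assoc (toℕ v) a (k * n)) ⟨
    (toℕ v + a + k * n) % n    ≡⟨ [m+kn]%n≡m%n (toℕ v + a) k n ⟩
    (toℕ v + a) % n            ∎)

  shift-% : ∀ a v → shift n (a % n) v ≡ shift n a v
  shift-% a v = shift-≡ (a % n) a v v ([a+b%n]%n≡[a+b]%n (toℕ v) a)

  shift-multiple : ∀ k v → shift n (n * k) v ≡ v
  shift-multiple k v = begin
    shift n (n * k) v      ≡⟨ cong (λ x → shift n x v) (*-comm n k) ⟩
    shift n (0 + k * n) v  ≡⟨ shift-periodic 0 k v ⟩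
    shift n 0 v            ≡⟨ shift-zero v ⟩
    v                      ∎

  -- m * k is a representative of -k modulo n = 1 + m.
  shift-inverseˡ : ∀ k v → shift n (m * k) (shift n k v) ≡ v
  shift-inverseˡ k v = trans (shift-shift (m * k) k v) (shift-multiple k v)

  shift-inverseʳ : ∀ k v → shift n k (shift n (m * k) v) ≡ v
  shift-inverseʳ k v = begin
    shift n k (shift n (m * k) v)  ≡⟨ shift-shift k (m * k) v ⟩
    shift n (m * k + k) v          ≡⟨ cong (λ x → shift n x v) (+-comm (m * k) k) ⟩
    shift n (n * k) v              ≡⟨ shift-multiple k v ⟩
    v                              ∎

  infixl 8 _·_
  _·_ : Word → ℕ → Word
  w · j = _∘σ^_ n w j

  ·-· : ∀ w a b → w · a · b ≗ w · (b + a)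
  ·-· w a b i = cong w (shift-shift a b i)

  ·-comm : ∀ w a b → w · a · b ≗ w · b · a
  ·-comm w a b i = begin
    (w · a · b) i    ≡⟨ ·-· w a b i ⟩
    (w · (b + a)) i  ≡⟨ cong (λ x → (w · x) i) (+-comm b a) ⟩
    (w · (a + b)) i  ≡⟨ ·-· w b a i ⟨
    (w · b · a) i    ∎

  ·-cancel : ∀ w k → w · k · (m * k) ≗ w
  ·-cancel w k i = cong w (shift-inverseʳ k i)

  ·-cong : ∀ {w w'} j → w ≗ w' → w · j ≗ w' · j
  ·-cong j eq i = eq (shift n j i)

  -- R₂ unfolds to an existential, from which the two words cannot be
  -- inferred; the record keeps them visible to unification.
  infix 4 _∼_
  record _∼_ (w w' : Word) : Set where
    constructor mk∼
    field get : R₂ n w w'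
  open _∼_

  ≗⇒∼ : ∀ {w w'} → w ≗ w' → w ∼ w'
  ≗⇒∼ {w} eq = mk∼ (0 , s≤s z≤n , λ i → trans (sym (eq i)) (sym (shift-zero (w i))))

  ∼-sym : ∀ {w w'} → w ∼ w' → w' ∼ w
  ∼-sym {w} {w'} (mk∼ (k , _ , eq)) = mk∼ (m * k % n , m%n<n (m * k) n , λ i → sym (begin
    shift n (m * k % n) (w' i)        ≡⟨ shift-% (m * k) (w' i) ⟩
    shift n (m * k) (w' i)            ≡⟨ cong (shift n (m * k)) (eq i) ⟩
    shift n (m * k) (shift n k (w i)) ≡⟨ shift-inverseˡ k (w i) ⟩
    w i                               ∎))

  ∼-trans : ∀ {w w' w''} → w ∼ w' → w' ∼ w'' → w ∼ w''
  ∼-trans {w} {w'} {w''} (mk∼ (k , _ , eq)) (mk∼ (k' , _ , eq')) =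
    mk∼ ((k + k') % n , m%n<n (k + k') n , λ i → begin
      w'' i                         ≡⟨ eq' i ⟩
      shift n k' (w' i)             ≡⟨ cong (shift n k') (eq i) ⟩
      shift n k' (shift n k (w i))  ≡⟨ shift-shift k' k (w i) ⟩
      shift n (k + k') (w i)        ≡⟨ shift-% (k + k') (w i) ⟨
      shift n ((k + k') % n) (w i)  ∎)

  ∼-· : ∀ {w w'} j → w ∼ w' → w · j ∼ w' · j
  ∼-· j (mk∼ (k , k<n , eq)) = mk∼ (k , k<n , λ i → eq (shift n j i))

  IsPermutation : Word → Set
  IsPermutation w = (∀ i j → w i ≡ w j → i ≡ j) × (∀ v → ∃[ i ] w i ≡ v)

  isPermutation? : ∀ w → Dec (IsPermutation w)
  isPermutation? w =
    Fin.all? (λ i → Fin.all? (λ j → (w i Fin.≟ w j) →-dec (i Fin.≟ j)))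
    ×-dec Fin.all? (λ v → Fin.any? (λ i → w i Fin.≟ v))

  word-isPermutation : ∀ π → IsPermutation (word n π)
  word-isPermutation π =
    (λ i j eq → trans (sym (inverseˡ π)) (trans (cong (π ⟨$⟩ˡ_) eq) (inverseˡ π))) ,
    (λ v → π ⟨$⟩ˡ v , inverseʳ π)

  ∼-isPermutation : ∀ {w w'} → w ∼ w' → IsPermutation w → IsPermutation w'
  ∼-isPermutation {w} {w'} (mk∼ (k , _ , eq)) (injective , surjective) = injective' , surjective'
    where
    injective' : ∀ i j → w' i ≡ w' j → i ≡ j
    injective' i j w'i≡w'j = injective i j (begin
      w i                                ≡⟨ shift-inverseˡ k (w i) ⟨
      shift n (m * k) (shift n k (w i))  ≡⟨ cong (shift n (m * k)) (trans (sym (eq i)) (trans w'i≡w'j (eq j))) ⟩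
      shift n (m * k) (shift n k (w j))  ≡⟨ shift-inverseˡ k (w j) ⟩
      w j                                ∎)
    surjective' : ∀ v → ∃[ i ] w' i ≡ v
    surjective' v with i , wi≡ ← surjective (shift n (m * k) v) =
      i , trans (eq i) (trans (cong (shift n k) wi≡) (shift-inverseʳ k v))

  SameOrbitʷ : Word → Word → Set
  SameOrbitʷ w w' = ∃[ j ] w · j ∼ w'

  sameOrbitʷ-sym : ∀ {w w'} → SameOrbitʷ w w' → SameOrbitʷ w' w
  sameOrbitʷ-sym {w} (j , w·j∼w') = m * j , ∼-trans (∼-· (m * j) (∼-sym w·j∼w')) (≗⇒∼ (·-cancel w j))

  sameOrbitʷ-rotations : ∀ {w w' v} a b → w ∼ v · a → w' ∼ v · b → SameOrbitʷ w w'
  sameOrbitʷ-rotations {v = v} a b w∼v·a w'∼v·b =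
    b + m * a , ∼-trans (∼-· (b + m * a) w∼v·a) (∼-trans (≗⇒∼ v·a·j≗v·b) (∼-sym w'∼v·b))
    where
    v·a·j≗v·b : v · a · (b + m * a) ≗ v · b
    v·a·j≗v·b i = trans (sym (·-· (v · a) (m * a) b i)) (·-cong b (·-cancel v a) i)

  HasPeriod : ℕ → Word → Set
  HasPeriod e w = w ∼ w · e

  hasPeriod-sameOrbitʷ : ∀ {w w'} e → SameOrbitʷ w w' → HasPeriod e w → HasPeriod e w'
  hasPeriod-sameOrbitʷ {w} {w'} e (j , w·j∼w') period =
    ∼-trans (∼-sym w·j∼w') (∼-trans (∼-· j period) (∼-trans (≗⇒∼ (·-comm w e j)) (∼-· e w·j∼w')))

  sameOrbit-sym : ∀ {π π'} → SameOrbit n π π' → SameOrbit n π' π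
  sameOrbit-sym {π} {π'} (j , r) with j' , mk∼ r' ← sameOrbitʷ-sym {word n π} {word n π'} (j , mk∼ r) = j' , r'

  period-sameOrbit : ∀ {π π'} e → SameOrbit n π π' →
                     R₂ n (word n π) (word n π · e) → R₂ n (word n π') (word n π' · e)
  period-sameOrbit {π} {π'} e (j , r) period =
    get (hasPeriod-sameOrbitʷ {word n π} {word n π'} e (j , mk∼ r) (mk∼ period))

  orbitSize-unique : ∀ {d d' π π'} → OrbitSize n d π → OrbitSize n d' π' → SameOrbit n π π' → d ≡ d'
  orbitSize-unique {d} {d'} {π} {π'} (1≤d , period , minimal) (1≤d' , period' , minimal') same with <-cmp d d'
  ... | tri< d<d' _ _ = ⊥-elim (minimal' d 1≤d d<d' (period-sameOrbit {π} {π'} d same period))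
  ... | tri≈ _ d≡d' _ = d≡d'
  ... | tri> _ _ d>d' =
    ⊥-elim (minimal d' 1≤d' d>d' (period-sameOrbit {π'} {π} d' (sameOrbit-sym {π} {π'} same) period'))

  module Windows (u : List (Fin n)) where

    window : ℕ → Word
    window p i = lookupOr Fin.zero u (p + toℕ i)

    window-≡ : ∀ {p q} i j → p + toℕ i ≡ q + toℕ j → window p i ≡ window q j
    window-≡ i j eq = cong (lookupOr Fin.zero u) eq

    PermutationAt : ℕ → Set
    PermutationAt p = IsPermutation (window p)

    -- The entering letter u(p + n) occurs in window p; anywhere but at its
    -- first position it would occur twice in window p + 1, so it is u(p).
    rotate-window : ∀ {p} → PermutationAt p → PermutationAt (suc p) → window (suc p) ≗ window p · 1
    rotate-window {p} (_ , onto) (one-one , _) i with toℕ i ≟ m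
    ... | no i≢m = window-≡ i (shift n 1 i) (begin
      suc p + toℕ i          ≡⟨ +-suc p (toℕ i) ⟨
      p + suc (toℕ i)        ≡⟨ cong (p +_) (m<n⇒m%n≡m (s≤s i<m)) ⟨
      p + (suc (toℕ i)) % n  ≡⟨ cong (λ x → p + x % n) (+-comm 1 (toℕ i)) ⟩
      p + (toℕ i + 1) % n    ≡⟨ cong (p +_) (toℕ-shift 1 i) ⟨
      p + toℕ (shift n 1 i)  ∎)
      where
      i<m : toℕ i < m
      i<m = ≤∧≢⇒< (≤-pred (Fin.toℕ<n i)) i≢m
    ... | yes i≡m with onto (window (suc p) i)
    ...   | Fin.zero , leaving≡entering =
      trans (sym leaving≡entering) (window-≡ Fin.zero (shift n 1 i) (cong (p +_) (sym wraps)))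
      where
      wraps : toℕ (shift n 1 i) ≡ 0
      wraps = begin
        toℕ (shift n 1 i)  ≡⟨ toℕ-shift 1 i ⟩
        (toℕ i + 1) % n    ≡⟨ cong (λ x → (x + 1) % n) i≡m ⟩
        (m + 1) % n        ≡⟨ cong (_% n) (+-comm m 1) ⟩
        n % n              ≡⟨ n%n≡0 n ⟩
        0                  ∎
    ...   | Fin.suc k , found = ⊥-elim (<-irrefl k≡m (Fin.toℕ<n k))
      where
      shared-letter : window (suc p) (inject₁ k) ≡ window p (Fin.suc k)
      shared-letter = window-≡ (inject₁ k) (Fin.suc k)
        (trans (cong (suc p +_) (Fin.toℕ-inject₁ k)) (sym (+-suc p (toℕ k))))
      k≡m : toℕ k ≡ m
      k≡m = begin
        toℕ k            ≡⟨ Fin.toℕ-inject₁ k ⟨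
        toℕ (inject₁ k)  ≡⟨ cong toℕ (one-one (inject₁ k) i (trans shared-letter found)) ⟩
        toℕ i            ≡⟨ i≡m ⟩
        m                ∎

    runStart : ℕ → ℕ
    runStart zero = zero
    runStart (suc p) with isPermutation? (window p)
    ... | yes _ = runStart p
    ... | no  _ = suc p

    runStart-≤ : ∀ p → runStart p ≤ p
    runStart-≤ zero = z≤n
    runStart-≤ (suc p) with isPermutation? (window p)
    ... | yes _ = m≤n⇒m≤1+n (runStart-≤ p)
    ... | no  _ = ≤-refl

    runStart-after-gap : ∀ p s → runStart p ≡ suc s → ¬ PermutationAt s
    runStart-after-gap (suc p) s start≡ with isPermutation? (window p)
    ... | yes _         = runStart-after-gap p s start≡
    ... | no  ¬permutation = subst (λ q → ¬ PermutationAt q) (suc-injective start≡) ¬permutation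

    runStart-rotation : ∀ p → PermutationAt p → ∃[ a ] window p ≗ window (runStart p) · a
    runStart-rotation zero _ = 0 , λ i → cong (window 0) (sym (shift-zero i))
    runStart-rotation (suc p) permutation with isPermutation? (window p)
    ... | no _ = 0 , λ i → cong (window (suc p)) (sym (shift-zero i))
    ... | yes permutation′ with a , rotated ← runStart-rotation p permutation′ =
      suc a , λ i → begin
        window (suc p) i                  ≡⟨ rotate-window permutation′ permutation i ⟩
        (window p · 1) i                  ≡⟨ ·-cong 1 rotated i ⟩
        (window (runStart p) · a · 1) i   ≡⟨ ·-· (window (runStart p)) a 1 i ⟩
        (window (runStart p) · suc a) i   ∎

  open Windows public

  factor-window : ∀ {u xs ys} (w : Word) → u ≡ xs ++ tabulate w ++ ys → window u (length xs) ≗ w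
  factor-window {xs = xs} {ys} w refl i =
    trans (lookupOr-++ Fin.zero xs _ (toℕ i)) (lookupOr-tabulate Fin.zero w ys i)

  -- σ^k ∘ π fixes 0 only for k = 0, so permutations fixing 0 lie in distinct classes.
  classRepresentative : Fin (m !) → Permutation′ n
  classRepresentative j = lift₀ (permutation m j)

  classRepresentative-injective : ∀ {j j'} →
    word n (classRepresentative j) ∼ word n (classRepresentative j') → j ≡ j'
  classRepresentative-injective {j} {j'} (mk∼ (k , k<n , eq)) =
    permutation-injective m λ t → Fin.suc-injective (begin
      lift₀ (permutation m j) ⟨$⟩ʳ Fin.suc t              ≡⟨ shift-zero _ ⟨
      shift n 0 (lift₀ (permutation m j) ⟨$⟩ʳ Fin.suc t)  ≡⟨ cong (λ x → shift n x (lift₀ (permutation m j) ⟨$⟩ʳ Fin.suc t)) k≡0 ⟨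
      shift n k (lift₀ (permutation m j) ⟨$⟩ʳ Fin.suc t)  ≡⟨ eq (Fin.suc t) ⟨
      lift₀ (permutation m j') ⟨$⟩ʳ Fin.suc t             ∎)
    where
    k≡0 : k ≡ 0
    k≡0 = sym (begin
      0                       ≡⟨ cong toℕ (eq Fin.zero) ⟩
      toℕ (shift n k Fin.zero) ≡⟨ toℕ-shift k Fin.zero ⟩
      k % n                   ≡⟨ m<n⇒m%n≡m k<n ⟩
      k                       ∎)

  DistinctOrbits : Permutation′ n → Permutation′ n → Set
  DistinctOrbits π π' = ¬ SameOrbit n π π'

  module _ (c : ℕ → ℕ) (cycles : ∀ d → d ∣ n → CyclesCount n d (c d)) where

    OrbitRepresentatives : List ℕ → Set
    OrbitRepresentatives ds = Σ (List (Permutation′ n)) λ ρs →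
      length ρs ≡ sum (map c ds) × AllPairs DistinctOrbits ρs × All (λ ρ → ∃[ d ] (d ∈ ds × OrbitSize n d ρ)) ρs

    orbitRepresentatives : ∀ ds → Unique ds → All (_∣ n) ds → OrbitRepresentatives ds
    orbitRepresentatives []       []           []            = [] , refl , [] , []
    orbitRepresentatives (d ∷ ds) (d∉ds ∷ uniq) (d∣n ∷ ds∣n)
      with ρs , length≡ , sizes , apart , _ ← cycles d d∣n
         | ρs' , length≡' , apart' , sizes' ← orbitRepresentatives ds uniq ds∣n
      = ρs ++ ρs'
      , trans (length-++ ρs) (cong₂ _+_ length≡ length≡')
      , AllPairs.++⁺ apart apart'
          (All.map (λ {ρ} size → All.map (λ {ρ'} (d' , d'∈ds , size') same →
             All.lookup d∉ds d'∈ds (orbitSize-unique {π = ρ} {π' = ρ'} size size' same)) sizes') sizes)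
      , All.++⁺ (All.map (λ size → d , here refl , size) sizes)
                (All.map (λ (d' , d'∈ds , size') → d' , there d'∈ds , size') sizes')

    divisorRepresentatives : Σ (List (Permutation′ n)) λ ρs → length ρs ≡ sumDiv n c × AllPairs DistinctOrbits ρs
    divisorRepresentatives
      with ρs , length≡ , apart , _ ←
             orbitRepresentatives (divisors n) (divisors-unique n) (All.all-filter (_∣? n) (applyUpTo suc n))
      = ρs , length≡ , apart

module LowerBound (m : ℕ) (u : List (Fin (suc m))) (universal : Universal (suc m) u) where

  open Rotation m

  position : Permutation′ n → ℕ
  position π = length (proj₁ (proj₂ (proj₂ (universal π))))

  position-∼ : ∀ π → word n π ∼ window u (position π)
  position-∼ π with π' , r , _ , _ , u≡ ← universal π =
    ∼-trans (mk∼ r) (≗⇒∼ (λ i → sym (factor-window π' u≡ i)))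

  position-fits : ∀ π → position π + n ≤ length u
  position-fits π with π' , _ , xs , ys , u≡ ← universal π =
    subst (λ v → length xs + n ≤ length v) (sym u≡) (length-++-tabulate-≥ xs π' ys)

  position-< : ∀ π → position π < length u ∸ m
  position-< π = m+n≤o⇒m≤o∸n (suc (position π)) (subst (_≤ length u) (+-suc (position π) m) (position-fits π))

  m≤length : m ≤ length u
  m≤length = ≤-trans (m≤n+m m (suc (position id))) (subst (_≤ length u) (+-suc (position id) m) (position-fits id))

  permutationAt-position : ∀ π → PermutationAt u (position π)
  permutationAt-position π = ∼-isPermutation (position-∼ π) (word-isPermutation π)

  position-class : ∀ {π π'} → position π ≡ position π' → word n π ∼ word n π'
  position-class {π} {π'} same =
    ∼-trans (position-∼ π) (subst (λ p → window u p ∼ word n π') (sym same) (∼-sym (position-∼ π')))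

  runStartOf : Permutation′ n → ℕ
  runStartOf ρ = runStart u (position ρ)

  runStart-sameOrbit : ∀ {π π'} → runStartOf π ≡ runStartOf π' → SameOrbit n π π'
  runStart-sameOrbit {π} {π'} same-start
    with a , rotated  ← runStart-rotation u (position π) (permutationAt-position π)
       | b , rotated' ← runStart-rotation u (position π') (permutationAt-position π')
    with j , mk∼ r ← sameOrbitʷ-rotations {v = window u (runStartOf π)} a b
           (∼-trans (position-∼ π) (≗⇒∼ rotated))
           (∼-trans (position-∼ π') (≗⇒∼ (subst (λ s → window u (position π') ≗ window u s · b)
                                                (sym same-start) rotated')))
    = j , r

  classPosition : Fin (m !) → ℕ
  classPosition j = suc (position (classRepresentative j))

  classPositions : List ℕ
  classPositions = tabulate classPosition

  runStarts : List (Permutation′ n) → List ℕ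
  runStarts = map runStartOf

  classPositions-unique : Unique classPositions
  classPositions-unique = Unique.tabulate⁺ λ eq → classRepresentative-injective (position-class (suc-injective eq))

  runStarts-unique : ∀ {ρs} → AllPairs DistinctOrbits ρs → Unique (runStarts ρs)
  runStarts-unique apart = AllPairs.map⁺ (AllPairs.map (λ distinct same → distinct (runStart-sameOrbit same)) apart)

  classPositions-disjoint-runStarts : ∀ ρs → Disjoint classPositions (runStarts ρs)
  classPositions-disjoint-runStarts ρs (v∈classes , v∈starts)
    with j , v≡ ← ∈-tabulate⁻ v∈classes
       | ρ , _ , v≡' ← ∈-map⁻ runStartOf v∈starts
    = runStart-after-gap u (position ρ) _ (trans (sym v≡') v≡) (permutationAt-position (classRepresentative j))

  positions : List (Permutation′ n) → List ℕ
  positions ρs = classPositions ++ runStarts ρs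

  positions-unique : ∀ {ρs} → AllPairs DistinctOrbits ρs → Unique (positions ρs)
  positions-unique {ρs} apart =
    Unique.++⁺ classPositions-unique (runStarts-unique apart) (classPositions-disjoint-runStarts ρs)

  positions-< : ∀ ρs → All (_< suc (length u ∸ m)) (positions ρs)
  positions-< ρs = All.++⁺
    (All.tabulate⁺ λ j → s≤s (position-< (classRepresentative j)))
    (All.map⁺ (All.universal (λ ρ → s≤s (≤-trans (runStart-≤ u (position ρ)) (<⇒≤ (position-< ρ)))) ρs))

  positions-count : ∀ {ρs} → AllPairs DistinctOrbits ρs → m ! + length ρs ≤ suc (length u ∸ m)
  positions-count {ρs} apart = begin
    m ! + length ρs                                ≡⟨ cong₂ _+_ (length-tabulate classPosition) (length-map runStartOf ρs) ⟨
    length classPositions + length (runStarts ρs)  ≡⟨ length-++ classPositions ⟨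
    length (positions ρs)                          ≤⟨ unique-bounded⇒length≤ (positions-unique apart) (positions-< ρs) ⟩
    suc (length u ∸ m)                             ∎
    where open ≤-Reasoning

  bound : (c : ℕ → ℕ) → (∀ d → d ∣ n → CyclesCount n d (c d)) → m ! + n + sumDiv n c ≤ length u + 2
  bound c cycles with ρs , length≡ , apart ← divisorRepresentatives c cycles = begin
    m ! + n + sumDiv n c            ≡⟨ +-assoc (m !) n _ ⟩
    m ! + (n + sumDiv n c)          ≡⟨ cong (m ! +_) (+-comm n _) ⟩
    m ! + (sumDiv n c + n)          ≡⟨ +-assoc (m !) _ n ⟨
    m ! + sumDiv n c + n            ≡⟨ cong (λ k → m ! + k + n) length≡ ⟨
    m ! + length ρs + n             ≤⟨ +-monoˡ-≤ n (positions-count apart) ⟩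
    suc (length u ∸ m) + n          ≡⟨ cong suc (+-suc (length u ∸ m) m) ⟩
    suc (suc (length u ∸ m + m))    ≡⟨ cong (λ k → suc (suc k)) (m∸n+n≡m m≤length) ⟩
    suc (suc (length u))            ≡⟨ +-comm 2 (length u) ⟩
    length u + 2                    ∎
    where open ≤-Reasoning

theorem6 : (n : ℕ) ⦃ nz : NonZero n ⦄ (c : ℕ → ℕ) →
    (∀ d → d ∣ n → CyclesCount n d (c d)) →
    (u : List (Fin n)) → Universal n u →
    (n ∸ 1) ! + n + sumDiv n c ≤ length u + 2
theorem6 (suc m) c cycles u universal = LowerBound.bound m u universal c cycles
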